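{- Let $k \ge 2$, let $G$ be a connected $SC_{2k+1}$ graph, and let $T$ be a breadth-first search tree of $G$ (rooted at some vertex). Then the set of non-tree edges $E(G)\setminus E(T)$ forms a matching, i.e. no two non-tree edges share an endpoint.
   Context: All graphs are finite, simple and undirected. For an integer $t$, a graph $G$ is an $SC_t$ graph if either $G$ has no cycle, or every induced cycle of $G$ has length exactly $t$. The non-tree edges of a spanning tree $T$ of $G$ are the edges of $G$ not in $T$. -}

module Defs where

open import Data.Nat using (ℕ; zero; suc; _+_; _*_; _≤_; _%_)
open import Data.Fin using (Fin; toℕ)
open import Data.Bool using (Bool; true; false)
open import Data.Product using (Σ; ∃; _×_; _,_)
open import Data.Sum using (_⊎_)
open import Relation.Binary.PropositionalEquality using (_≡_; _≢_)
open import Relation.Nullary using (¬_)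
open import Function.Definitions using (Injective)
open import Function.Bundles using (_⇔_)

record Graph (n : ℕ) : Set where
  field
    adj    : Fin n → Fin n → Bool
    sym    : ∀ u v → adj u v ≡ adj v u
    irrefl : ∀ v → adj v v ≡ false

open Graph public

Adj : ∀ {n} → Graph n → Fin n → Fin n → Set
Adj G u v = adj G u v ≡ true

data Walk {n : ℕ} (G : Graph n) : Fin n → Fin n → ℕ → Set where
  here : ∀ {u} → Walk G u u zero
  step : ∀ {u w v l} → Adj G u w → Walk G w v l → Walk G u v (suc l)

Connected : ∀ {n} → Graph n → Set
Connected G = ∀ u v → ∃ λ l → Walk G u v l

Dist : ∀ {n} → Graph n → Fin n → Fin n → ℕ → Set
Dist G u v d = Walk G u v d × (∀ l → Walk G u v l → d ≤ l)

CycAdj : (m : ℕ) → Fin (3 + m) → Fin (3 + m) → Set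
CycAdj m i j = (toℕ j ≡ (suc (toℕ i)) % (3 + m)) ⊎ (toℕ i ≡ (suc (toℕ j)) % (3 + m))

record InducedCycle {n : ℕ} (G : Graph n) (m : ℕ) : Set where
  field
    vert    : Fin (3 + m) → Fin n
    inj     : Injective _≡_ _≡_ vert
    induced : ∀ i j → Adj G (vert i) (vert j) ⇔ CycAdj m i j

SC : ℕ → ∀ {n} → Graph n → Set
SC t G = ∀ m → InducedCycle G m → 3 + m ≡ t

-- A breadth-first search tree of G rooted at r, given by its parent map:
-- every vertex v ≠ r is joined in T to a G-neighbour whose distance from r
-- is one less than that of v.
record BFSTree {n : ℕ} (G : Graph n) (r : Fin n) : Set where
  field
    parent     : (v : Fin n) → v ≢ r → Fin n
    parent-adj : ∀ v (h : v ≢ r) → Adj G v (parent v h)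
    parent-dist : ∀ v (h : v ≢ r) d → Dist G r v (suc d) → Dist G r (parent v h) d

open BFSTree public

TreeEdge : ∀ {n} {G : Graph n} {r : Fin n} → BFSTree G r → Fin n → Fin n → Set
TreeEdge {r = r} T u v =
  (Σ (v ≢ r) λ h → parent T v h ≡ u) ⊎ (Σ (u ≢ r) λ h → parent T u h ≡ v)

NonTreeEdge : ∀ {n} {G : Graph n} {r : Fin n} → BFSTree G r → Fin n → Fin n → Set
NonTreeEdge {G = G} T u v = Adj G u v × ¬ TreeEdge T u v

-- Write δ for the depth in the BFS tree, and call w a lower neighbour of v when vw is an
-- edge and δ w = δ v − 1.  As every induced cycle has length 2k + 1 ≥ 5, G has no
-- triangles and no induced squares.  The main tool is an arch: an induced path whose ends
-- lie on one layer and whose other vertices do not go below it.  Adding the parents of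
-- the two ends gives again an arch, two edges longer, until the ends become adjacent or
-- acquire a common lower neighbour; then an induced cycle closes, of length ℓ + 2j + 1 or
-- ℓ + 2j + 2 after j steps.  Since that length is 2k + 1, the number of steps and the way
-- the ends meet depend only on ℓ.  For instance two lower neighbours of a vertex have
-- adjacent ancestors k − 1 generations back, so no vertex has three lower neighbours,
-- which excludes two non-tree edges going down from one vertex.  Every other pair of
-- non-tree edges at a vertex contains arches whose meetings produce a forbidden pair
-- closer to the root, so these pairs are excluded by induction on depth.

module Submission where

open import Defs hiding (sym)
open import Data.Nat using (ℕ; zero; suc; _+_; _*_; _≤_; _<_; _∸_; z≤n; s≤s; _≤?_)
open import Data.Nat.Properties
open import Data.Nat.DivMod using (_%_; m<n⇒m%n≡m; n%n≡0)
open import Data.Fin using (Fin; toℕ) renaming (_≟_ to _≟ᶠ_)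
open import Data.Fin.Properties using (any?; toℕ-injective; toℕ<n)
open import Data.Bool using (true) renaming (_≟_ to _≟ᵇ_)
open import Data.Product using (Σ; Σ-syntax; ∃-syntax; _×_; _,_; proj₁; proj₂)
open import Data.Sum using (_⊎_; inj₁; inj₂)
open import Data.Empty using (⊥; ⊥-elim)
open import Function.Bundles using (mk⇔)
open import Relation.Binary.Definitions using (tri<; tri≈; tri>)
open import Relation.Binary.PropositionalEquality
  using (_≡_; _≢_; refl; sym; trans; cong; cong₂; subst; subst₂; ≢-sym; module ≡-Reasoning)
open import Relation.Nullary using (¬_; Dec; yes; no)
open import Relation.Nullary.Decidable using (_×-dec_)

least-witness : {P : ℕ → Set} → (∀ l → Dec (P l)) → ∀ l → P l →
                ∃[ d ] P d × (∀ j → P j → d ≤ j)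
least-witness {P} P? l p = search 0 l (λ _ ()) (subst P (sym (+-identityʳ l)) p)
  where
  search : ∀ i fuel → (∀ j → j < i → ¬ P j) → P (fuel + i) →
           ∃[ d ] P d × (∀ j → P j → d ≤ j)
  search i fuel none-below p with P? i
  ... | yes pᵢ = i , pᵢ , λ j pⱼ → ≮⇒≥ (λ j<i → none-below j j<i pⱼ)
  search i zero none-below p | no ¬pᵢ = ⊥-elim (¬pᵢ p)
  search i (suc fuel) none-below p | no ¬pᵢ =
    search (suc i) fuel none-below′ (subst P (sym (+-suc fuel i)) p)
    where
    none-below′ : ∀ j → j < suc i → ¬ P j
    none-below′ j j<1+i with m≤n⇒m<n∨m≡n (≤-pred j<1+i)
    ... | inj₁ j<i = none-below j j<i
    ... | inj₂ refl = ¬pᵢ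

2+m+2*n≡m+2*[1+n] : ∀ m n → 2 + m + 2 * n ≡ m + 2 * suc n
2+m+2*n≡m+2*[1+n] m n = begin
  suc (suc (m + 2 * n))  ≡⟨ cong suc (sym (+-suc m (2 * n))) ⟩
  suc (m + suc (2 * n))  ≡⟨ sym (+-suc m (suc (2 * n))) ⟩
  m + suc (suc (2 * n))  ≡⟨ cong (m +_) (sym (*-suc 2 n)) ⟩
  m + 2 * suc n          ∎
  where open ≡-Reasoning

injective-on : ∀ {A : Set} (f : ℕ → A) ℓ → (∀ i j → i < j → j ≤ ℓ → f i ≢ f j) →
               ∀ i j → i ≤ ℓ → j ≤ ℓ → f i ≡ f j → i ≡ j
injective-on f ℓ distinct i j i≤ℓ j≤ℓ e with <-cmp i j
... | tri< i<j _ _ = ⊥-elim (distinct i j i<j j≤ℓ e)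
... | tri≈ _ i≡j _ = i≡j
... | tri> _ _ j<i = ⊥-elim (distinct j i j<i i≤ℓ (sym e))

module GraphBasics {n : ℕ} (G : Graph n) where

  adj-sym : ∀ {u v} → Adj G u v → Adj G v u
  adj-sym {u} {v} a = trans (Graph.sym G v u) a

  adj-irrefl : ∀ {u v} → Adj G u v → u ≢ v
  adj-irrefl {u} a refl with trans (sym a) (irrefl G u)
  ... | ()

  adj? : ∀ u v → Dec (Adj G u v)
  adj? u v = adj G u v ≟ᵇ true

  walk? : ∀ u v l → Dec (Walk G u v l)
  walk? u v zero with u ≟ᶠ v
  ... | yes refl = yes here
  ... | no u≢v = no λ { here → u≢v refl }
  walk? u v (suc l) with any? (λ w → adj? u w ×-dec walk? w v l)
  ... | yes (w , a , p) = yes (step a p)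
  ... | no ¬p = no λ { (step {w = w} a p) → ¬p (w , a , p) }

  walk-snoc : ∀ {a b c l} → Walk G a b l → Adj G b c → Walk G a c (suc l)
  walk-snoc here e = step e here
  walk-snoc (step x p) e = step x (walk-snoc p e)

  walk-zero : ∀ {u v} → Walk G u v 0 → u ≡ v
  walk-zero here = refl

module Paths {n : ℕ} (G : Graph n) where

  open GraphBasics G

  -- The pair (0, ℓ) may be adjacent, so this also describes an induced cycle
  -- closed by the edge between the two ends.
  record InducedPath (ℓ : ℕ) : Set where
    field
      vertex    : ℕ → Fin n
      distinct  : ∀ i j → i < j → j ≤ ℓ → vertex i ≢ vertex j
      adjacent  : ∀ i → i < ℓ → Adj G (vertex i) (vertex (suc i))
      chordless : ∀ i j → i < j → j ≤ ℓ → Adj G (vertex i) (vertex j) →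
                  j ≡ suc i ⊎ (i ≡ 0 × j ≡ ℓ)

  open InducedPath public

  InducedCycleOfLength : ℕ → Set
  InducedCycleOfLength t = Σ[ m ∈ ℕ ] InducedCycle G m × 3 + m ≡ t

  close : ∀ {ℓ} (P : InducedPath ℓ) → 2 ≤ ℓ → Adj G (vertex P 0) (vertex P ℓ) →
          InducedCycleOfLength (suc ℓ)
  close {suc (suc m)} P _ ends-adj = m , cycle , refl
    where
    v = vertex P
    bound : (i : Fin (3 + m)) → toℕ i ≤ suc (suc m)
    bound i = ≤-pred (toℕ<n i)
    succ-mod : ∀ a → a < suc (suc m) → suc a % (3 + m) ≡ suc a
    succ-mod a a<ℓ = m<n⇒m%n≡m (s≤s a<ℓ)
    wrap : ∀ {a} → a ≡ suc (suc m) → suc a % (3 + m) ≡ 0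
    wrap refl = n%n≡0 (3 + m)
    to : ∀ i j → Adj G (v (toℕ i)) (v (toℕ j)) → CycAdj m i j
    to i j a with <-cmp (toℕ i) (toℕ j)
    ... | tri< i<j _ _ with chordless P _ _ i<j (bound j) a
    ...   | inj₁ e = inj₁ (trans e (sym (succ-mod (toℕ i) (<-≤-trans i<j (bound j)))))
    ...   | inj₂ (i≡0 , j≡ℓ) = inj₂ (trans i≡0 (sym (wrap j≡ℓ)))
    to i j a | tri≈ _ e _ = ⊥-elim (adj-irrefl a (cong v e))
    to i j a | tri> _ _ j<i with chordless P _ _ j<i (bound i) (adj-sym a)
    ...   | inj₁ e = inj₂ (trans e (sym (succ-mod (toℕ j) (<-≤-trans j<i (bound i)))))
    ...   | inj₂ (j≡0 , i≡ℓ) = inj₁ (trans j≡0 (sym (wrap i≡ℓ)))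
    from-succ : ∀ i j → toℕ j ≡ suc (toℕ i) % (3 + m) → Adj G (v (toℕ i)) (v (toℕ j))
    from-succ i j e with m≤n⇒m<n∨m≡n (bound i)
    ... | inj₁ i<ℓ = subst (λ x → Adj G (v (toℕ i)) (v x))
                       (sym (trans e (succ-mod (toℕ i) i<ℓ))) (adjacent P _ i<ℓ)
    ... | inj₂ i≡ℓ = subst₂ (λ x y → Adj G (v x) (v y)) (sym i≡ℓ)
                       (sym (trans e (wrap i≡ℓ))) (adj-sym ends-adj)
    from : ∀ i j → CycAdj m i j → Adj G (v (toℕ i)) (v (toℕ j))
    from i j (inj₁ e) = from-succ i j e
    from i j (inj₂ e) = adj-sym (from-succ j i e)
    cycle : InducedCycle G m
    cycle = record
      { vert    = λ i → v (toℕ i)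
      ; inj     = λ {i} {j} e → toℕ-injective
                    (injective-on v _ (distinct P) (toℕ i) (toℕ j) (bound i) (bound j) e)
      ; induced = λ i j → mk⇔ (to i j) (from i j) }
  close {suc zero} P (s≤s ())

  single : Fin n → InducedPath 0
  single u = record
    { vertex    = λ _ → u
    ; distinct  = λ { _ _ i<j z≤n → ⊥-elim (n≮0 i<j) }
    ; adjacent  = λ _ ()
    ; chordless = λ { _ _ i<j z≤n _ → ⊥-elim (n≮0 i<j) } }

  one-or-more : ∀ {ℓ} → 0 < ℓ → ℓ ≡ 1 ⊎ 2 ≤ ℓ
  one-or-more {suc zero} _ = inj₁ refl
  one-or-more {suc (suc _)} _ = inj₂ (s≤s (s≤s z≤n))

  prepend : ∀ {ℓ} (P : InducedPath ℓ) w →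
            (∀ i → i ≤ ℓ → vertex P i ≢ w) → Adj G w (vertex P 0) →
            (∀ i → 0 < i → i < ℓ → ¬ Adj G w (vertex P i)) →
            (2 ≤ ℓ → ¬ Adj G (vertex P 0) (vertex P ℓ)) → InducedPath (suc ℓ)
  prepend {ℓ} P w fresh w-adj w-clear ends-apart = record
    { vertex = v ; distinct = v-distinct ; adjacent = v-adjacent ; chordless = v-chordless }
    where
    v : ℕ → Fin n
    v zero = w
    v (suc i) = vertex P i
    v-distinct : ∀ i j → i < j → j ≤ suc ℓ → v i ≢ v j
    v-distinct zero (suc j) _ (s≤s j≤ℓ) e = fresh j j≤ℓ (sym e)
    v-distinct (suc i) (suc j) (s≤s i<j) (s≤s j≤ℓ) = distinct P i j i<j j≤ℓ
    v-adjacent : ∀ i → i < suc ℓ → Adj G (v i) (v (suc i))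
    v-adjacent zero _ = w-adj
    v-adjacent (suc i) (s≤s i<ℓ) = adjacent P i i<ℓ
    v-chordless : ∀ i j → i < j → j ≤ suc ℓ → Adj G (v i) (v j) →
                  j ≡ suc i ⊎ (i ≡ 0 × j ≡ suc ℓ)
    v-chordless zero (suc zero) _ _ _ = inj₁ refl
    v-chordless zero (suc (suc j)) _ (s≤s j<ℓ) a with m≤n⇒m<n∨m≡n j<ℓ
    ... | inj₁ j<ℓ′ = ⊥-elim (w-clear (suc j) (s≤s z≤n) j<ℓ′ a)
    ... | inj₂ refl = inj₂ (refl , refl)
    v-chordless (suc i) (suc j) (s≤s i<j) (s≤s j≤ℓ) a with chordless P i j i<j j≤ℓ a
    ... | inj₁ refl = inj₁ refl
    ... | inj₂ (refl , refl) with one-or-more i<j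
    ...   | inj₁ refl = inj₁ refl
    ...   | inj₂ 2≤ℓ = ⊥-elim (ends-apart 2≤ℓ a)

  below-or-top : ∀ {j ℓ} → j ≤ suc ℓ → j ≤ ℓ ⊎ j ≡ suc ℓ
  below-or-top j≤1+ℓ with m≤n⇒m<n∨m≡n j≤1+ℓ
  ... | inj₁ j<1+ℓ = inj₁ (≤-pred j<1+ℓ)
  ... | inj₂ refl = inj₂ refl

  start-inner-end : ∀ {i ℓ} → i ≤ ℓ → i ≡ 0 ⊎ (0 < i × i < ℓ) ⊎ i ≡ ℓ
  start-inner-end {zero} _ = inj₁ refl
  start-inner-end {suc i} i≤ℓ with m≤n⇒m<n∨m≡n i≤ℓ
  ... | inj₁ i<ℓ = inj₂ (inj₁ (s≤s z≤n , i<ℓ))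
  ... | inj₂ refl = inj₂ (inj₂ refl)

  extend : (ℕ → Fin n) → ℕ → Fin n → ℕ → Fin n
  extend f ℓ w i with i ≤? ℓ
  ... | yes _ = f i
  ... | no _ = w

  extend-≤ : ∀ f ℓ w {i} → i ≤ ℓ → extend f ℓ w i ≡ f i
  extend-≤ f ℓ w {i} i≤ℓ with i ≤? ℓ
  ... | yes _ = refl
  ... | no i≰ℓ = ⊥-elim (i≰ℓ i≤ℓ)

  extend-end : ∀ f ℓ w → extend f ℓ w (suc ℓ) ≡ w
  extend-end f ℓ w with suc ℓ ≤? ℓ
  ... | yes 1+ℓ≤ℓ = ⊥-elim (n≮n ℓ 1+ℓ≤ℓ)
  ... | no _ = refl

  append : ∀ {ℓ} (P : InducedPath ℓ) w →
           (∀ i → i ≤ ℓ → vertex P i ≢ w) → Adj G (vertex P ℓ) w →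
           (∀ i → 0 < i → i < ℓ → ¬ Adj G (vertex P i) w) →
           (2 ≤ ℓ → ¬ Adj G (vertex P 0) (vertex P ℓ)) → InducedPath (suc ℓ)
  append {ℓ} P w fresh w-adj w-clear ends-apart = record
    { vertex = v ; distinct = v-distinct ; adjacent = v-adjacent ; chordless = v-chordless }
    where
    v = extend (vertex P) ℓ w
    old : ∀ {i} → i ≤ ℓ → v i ≡ vertex P i
    old = extend-≤ (vertex P) ℓ w
    new : v (suc ℓ) ≡ w
    new = extend-end (vertex P) ℓ w
    v-distinct : ∀ i j → i < j → j ≤ suc ℓ → v i ≢ v j
    v-distinct i j i<j j≤1+ℓ e with below-or-top j≤1+ℓ
    ... | inj₁ j≤ℓ = distinct P i j i<j j≤ℓ
                       (trans (sym (old (<⇒≤ (<-≤-trans i<j j≤ℓ)))) (trans e (old j≤ℓ)))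
    ... | inj₂ refl = fresh i (≤-pred i<j) (trans (sym (old (≤-pred i<j))) (trans e new))
    v-adjacent : ∀ i → i < suc ℓ → Adj G (v i) (v (suc i))
    v-adjacent i i<1+ℓ with below-or-top i<1+ℓ
    ... | inj₁ i<ℓ = subst₂ (Adj G) (sym (old (<⇒≤ i<ℓ))) (sym (old i<ℓ)) (adjacent P i i<ℓ)
    ... | inj₂ refl = subst₂ (Adj G) (sym (old ≤-refl)) (sym new) w-adj
    v-chordless : ∀ i j → i < j → j ≤ suc ℓ → Adj G (v i) (v j) →
                  j ≡ suc i ⊎ (i ≡ 0 × j ≡ suc ℓ)
    v-chordless i j i<j j≤1+ℓ a with below-or-top j≤1+ℓ
    ... | inj₁ j≤ℓ
        with chordless P i j i<j j≤ℓ (subst₂ (Adj G) (old (<⇒≤ (<-≤-trans i<j j≤ℓ))) (old j≤ℓ) a)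
    ...   | inj₁ e = inj₁ e
    ...   | inj₂ (refl , refl) with one-or-more i<j
    ...     | inj₁ refl = inj₁ refl
    ...     | inj₂ 2≤ℓ = ⊥-elim (ends-apart 2≤ℓ
                           (subst₂ (Adj G) (old z≤n) (old ≤-refl) a))
    v-chordless i j i<j j≤1+ℓ a | inj₂ refl with start-inner-end {i} {ℓ} (≤-pred i<j)
    ... | inj₁ refl = inj₂ (refl , refl)
    ... | inj₂ (inj₁ (0<i , i<ℓ)) =
          ⊥-elim (w-clear i 0<i i<ℓ (subst₂ (Adj G) (old (≤-pred i<j)) new a))
    ... | inj₂ (inj₂ refl) = inj₁ refl

  path₂ : ∀ {a b c} → a ≢ b → a ≢ c → b ≢ c → Adj G a b → Adj G b c → InducedPath 2
  path₂ {a} {b} {c} a≢b a≢c b≢c ab bc =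
    prepend (prepend (single c) b (λ _ _ → ≢-sym b≢c) bc (λ _ _ ()) λ ())
            a (λ { zero _ → ≢-sym a≢b ; (suc _) _ → ≢-sym a≢c }) ab
            (λ { zero () ; (suc _) _ (s≤s ()) }) λ { (s≤s ()) }

  path₃ : ∀ {a b c d} → a ≢ b → a ≢ c → a ≢ d → b ≢ c → b ≢ d → c ≢ d →
          Adj G a b → Adj G b c → Adj G c d → ¬ Adj G a c → ¬ Adj G b d → InducedPath 3
  path₃ a≢b a≢c a≢d b≢c b≢d c≢d ab bc cd a≁c b≁d =
    prepend (path₂ b≢c b≢d c≢d bc cd) _
            (λ { 0 _ → ≢-sym a≢b ; 1 _ → ≢-sym a≢c ; (suc (suc _)) _ → ≢-sym a≢d }) ab
            (λ { zero () ; 1 _ _ → a≁c ; (suc (suc _)) _ (s≤s (s≤s ())) }) λ _ → b≁d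

  path₄ : ∀ {a b c d e} → a ≢ b → a ≢ c → a ≢ d → a ≢ e → b ≢ c → b ≢ d → b ≢ e →
          c ≢ d → c ≢ e → d ≢ e →
          Adj G a b → Adj G b c → Adj G c d → Adj G d e →
          ¬ Adj G a c → ¬ Adj G a d → ¬ Adj G b d → ¬ Adj G b e → ¬ Adj G c e →
          InducedPath 4
  path₄ a≢b a≢c a≢d a≢e b≢c b≢d b≢e c≢d c≢e d≢e ab bc cd de a≁c a≁d b≁d b≁e c≁e =
    prepend (path₃ b≢c b≢d b≢e c≢d c≢e d≢e bc cd de b≁d c≁e) _
            (λ { 0 _ → ≢-sym a≢b ; 1 _ → ≢-sym a≢c ; 2 _ → ≢-sym a≢d
               ; (suc (suc (suc _))) _ → ≢-sym a≢e }) ab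
            (λ { zero () ; 1 _ _ → a≁c ; 2 _ _ → a≁d
               ; (suc (suc (suc _))) _ (s≤s (s≤s (s≤s ()))) }) λ _ → b≁e

  triangle : ∀ {a b c} → a ≢ b → a ≢ c → b ≢ c →
             Adj G a b → Adj G b c → Adj G a c → InducedCycleOfLength 3
  triangle a≢b a≢c b≢c ab bc ac = close (path₂ a≢b a≢c b≢c ab bc) (s≤s (s≤s z≤n)) ac

  square : ∀ {a b c d} → a ≢ b → a ≢ c → a ≢ d → b ≢ c → b ≢ d → c ≢ d →
           Adj G a b → Adj G b c → Adj G c d → Adj G a d → ¬ Adj G a c → ¬ Adj G b d →
           InducedCycleOfLength 4
  square a≢b a≢c a≢d b≢c b≢d c≢d ab bc cd ad a≁c b≁d =
    close (path₃ a≢b a≢c a≢d b≢c b≢d c≢d ab bc cd a≁c b≁d) (s≤s (s≤s z≤n)) ad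

module BreadthFirst {n : ℕ} (G : Graph n) (conn : Connected G) (r : Fin n) (T : BFSTree G r) where

  open GraphBasics G
  open Paths G

  distance : ∀ v → ∃[ d ] Dist G r v d
  distance v = least-witness (walk? r v) (proj₁ (conn r v)) (proj₂ (conn r v))

  δ : Fin n → ℕ
  δ v = proj₁ (distance v)

  δ-walk : ∀ v → Walk G r v (δ v)
  δ-walk v = proj₁ (proj₂ (distance v))

  δ-minimal : ∀ v l → Walk G r v l → δ v ≤ l
  δ-minimal v = proj₂ (proj₂ (distance v))

  δ-unique : ∀ v d → Dist G r v d → d ≡ δ v
  δ-unique v d (w , minimal) = ≤-antisym (minimal (δ v) (δ-walk v)) (δ-minimal v d w)

  δ-root : δ r ≡ 0
  δ-root = n≤0⇒n≡0 (δ-minimal r 0 here)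

  δ≡0⇒root : ∀ {v} → δ v ≡ 0 → v ≡ r
  δ≡0⇒root {v} e = sym (walk-zero (subst (Walk G r v) e (δ-walk v)))

  δ≡suc⇒non-root : ∀ {v d} → δ v ≡ suc d → v ≢ r
  δ≡suc⇒non-root e refl with trans (sym e) δ-root
  ... | ()

  δ-adj : ∀ {u v} → Adj G u v → δ v ≤ suc (δ u)
  δ-adj {u} {v} a = δ-minimal v (suc (δ u)) (walk-snoc (δ-walk u) a)

  δ-<⇒≢ : ∀ {v w} → δ v < δ w → v ≢ w
  δ-<⇒≢ v<w refl = <-irrefl refl v<w

  far-apart : ∀ {u v} → suc (δ u) < δ v → ¬ Adj G u v
  far-apart 1+u<v a = <-irrefl refl (<-≤-trans 1+u<v (δ-adj a))

  Below : Fin n → Fin n → Set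
  Below v w = Adj G v w × suc (δ w) ≡ δ v

  below? : ∀ v w → Dec (Below v w)
  below? v w = adj? v w ×-dec (suc (δ w) ≟ δ v)

  below-< : ∀ {v w} → Below v w → δ w < δ v
  below-< (_ , e) = ≤-reflexive e

  below-≢ : ∀ {v w} → Below v w → w ≢ v
  below-≢ b = δ-<⇒≢ (below-< b)

  below-adj : ∀ {v w} → Below v w → Adj G w v
  below-adj (a , _) = adj-sym a

  below-δ : ∀ {v a b} → Below v a → Below v b → δ a ≡ δ b
  below-δ (_ , ea) (_ , eb) = suc-injective (trans ea (sym eb))

  below-non-root : ∀ {v w} → Below v w → v ≢ r
  below-non-root (_ , e) = δ≡suc⇒non-root (sym e)

  adj-<⇒below : ∀ {v w} → Adj G v w → δ w < δ v → Below v w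
  adj-<⇒below {v} {w} a w<v = a , ≤-antisym w<v (δ-adj (adj-sym a))

  CommonBelow : Fin n → Fin n → Set
  CommonBelow u v = Σ[ w ∈ Fin n ] Below u w × Below v w

  commonBelow? : ∀ u v → Dec (CommonBelow u v)
  commonBelow? u v = any? (λ w → below? u w ×-dec below? v w)

  TwoBelow : Fin n → Set
  TwoBelow v = Σ[ a ∈ Fin n ] Σ[ b ∈ Fin n ] a ≢ b × Below v a × Below v b

  parentOf : Fin n → Fin n
  parentOf v with v ≟ᶠ r
  ... | yes _ = r
  ... | no v≢r = parent T v v≢r

  parentOf-tree : ∀ {v w} → v ≢ r → w ≡ parentOf v → Σ (v ≢ r) λ h → parent T v h ≡ w
  parentOf-tree {v} v≢r refl with v ≟ᶠ r
  ... | yes v≡r = ⊥-elim (v≢r v≡r)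
  ... | no h = h , refl

  parentOf-below : ∀ {v} → v ≢ r → Below v (parentOf v)
  parentOf-below {v} v≢r with v ≟ᶠ r
  ... | yes v≡r = ⊥-elim (v≢r v≡r)
  ... | no h with δ v in eq
  ...   | zero = ⊥-elim (h (δ≡0⇒root eq))
  ...   | suc d = parent-adj T v h , cong suc (sym (δ-unique (parent T v h) d
                    (parent-dist T v h d (subst (Walk G r v) eq (δ-walk v) ,
                                          λ l w → subst (_≤ l) eq (δ-minimal v l w)))))

  parentOf-root : parentOf r ≡ r
  parentOf-root with r ≟ᶠ r
  ... | yes _ = refl
  ... | no r≢r = ⊥-elim (r≢r refl)

  parentOf-δ : ∀ v → δ (parentOf v) ≡ δ v ∸ 1
  parentOf-δ v = by-cases (v ≟ᶠ r)
    where
    by-cases : Dec (v ≡ r) → δ (parentOf v) ≡ δ v ∸ 1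
    by-cases (yes refl) = trans (cong δ parentOf-root) (trans δ-root (cong (_∸ 1) (sym δ-root)))
    by-cases (no v≢r) = cong (_∸ 1) (proj₂ (parentOf-below v≢r))

  other-below : ∀ {v} u → TwoBelow v → Σ[ w ∈ Fin n ] Below v w × w ≢ u
  other-below u (a , b , a≢b , below-a , below-b) with a ≟ᶠ u
  ... | no a≢u = a , below-a , a≢u
  ... | yes refl = b , below-b , ≢-sym a≢b

  other-than-parent : ∀ {v w} → Below v w → w ≢ parentOf v → TwoBelow v
  other-than-parent {v} {w} b w≢p = w , parentOf v , w≢p , b , parentOf-below (below-non-root b)

  ancestor : ℕ → Fin n → Fin n
  ancestor zero v = v
  ancestor (suc j) v = ancestor j (parentOf v)

  ancestor-suc : ∀ j v → ancestor (suc j) v ≡ parentOf (ancestor j v)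
  ancestor-suc zero v = refl
  ancestor-suc (suc j) v = ancestor-suc j (parentOf v)

  ancestor-δ : ∀ j v → δ (ancestor j v) ≡ δ v ∸ j
  ancestor-δ zero v = refl
  ancestor-δ (suc j) v =
    trans (ancestor-δ j (parentOf v)) (trans (cong (_∸ j) (parentOf-δ v)) (∸-+-assoc (δ v) 1 j))

  ancestor-δ-≤ : ∀ j v → δ (ancestor j v) ≤ δ v
  ancestor-δ-≤ j v = subst (_≤ δ v) (sym (ancestor-δ j v)) (m∸n≤m (δ v) j)

  ancestor-δ-≡ : ∀ j {u v} → δ u ≡ δ v → δ (ancestor j u) ≡ δ (ancestor j v)
  ancestor-δ-≡ j {u} {v} e = trans (ancestor-δ j u) (trans (cong (_∸ j) e) (sym (ancestor-δ j v)))

  ancestor-≢ : ∀ j {u v} → ancestor (suc j) u ≢ ancestor (suc j) v → ancestor j u ≢ ancestor j v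
  ancestor-≢ j {u} {v} ne e = ne (trans (ancestor-suc j u) (trans (cong parentOf e) (sym (ancestor-suc j v))))

  ancestor-below : ∀ j {v} → ancestor j v ≢ r → Below (ancestor j v) (ancestor (suc j) v)
  ancestor-below j {v} h = subst (Below (ancestor j v)) (sym (ancestor-suc j v)) (parentOf-below h)

  ancestor-< : ∀ j {v} → v ≢ r → δ (ancestor (suc j) v) < δ v
  ancestor-< j {v} h = ≤-trans (s≤s (ancestor-δ-≤ j (parentOf v))) (below-< (parentOf-below h))

  data Meeting : Set where
    edge-at wedge-at : ℕ → Meeting

  later : Meeting → Meeting
  later (edge-at j) = edge-at (suc j)
  later (wedge-at j) = wedge-at (suc j)

  Meets : Meeting → Fin n → Fin n → Set
  Meets (edge-at j) u v = Adj G (ancestor j u) (ancestor j v)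
  Meets (wedge-at j) u v = CommonBelow (ancestor j u) (ancestor j v) × ¬ Adj G (ancestor j u) (ancestor j v)

  -- The fall-back case h = 0 is never
  -- reached from distinct vertices of depth h.
  meet : ℕ → Fin n → Fin n → Meeting
  meet′ : ℕ → (u v : Fin n) → Dec (Adj G u v) → Dec (CommonBelow u v) → Meeting
  meet h u v = meet′ h u v (adj? u v) (commonBelow? u v)
  meet′ _ _ _ (yes _) _ = edge-at 0
  meet′ _ _ _ (no _) (yes _) = wedge-at 0
  meet′ zero _ _ (no _) (no _) = edge-at 0
  meet′ (suc h) u v (no _) (no _) = later (meet h (parentOf u) (parentOf v))

  meet-spec : ∀ h {u v} → u ≢ v → δ u ≡ h → δ v ≡ h → Meets (meet h u v) u v
  meet-spec′ : ∀ h {u v} → u ≢ v → δ u ≡ h → δ v ≡ h →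
               (a : Dec (Adj G u v)) (c : Dec (CommonBelow u v)) → Meets (meet′ h u v a c) u v
  meet-spec h {u} {v} u≢v eu ev = meet-spec′ h u≢v eu ev (adj? u v) (commonBelow? u v)
  meet-spec′ _ _ _ _ (yes a) _ = a
  meet-spec′ _ _ _ _ (no ¬a) (yes c) = c , ¬a
  meet-spec′ zero u≢v eu ev (no _) (no _) = ⊥-elim (u≢v (trans (δ≡0⇒root eu) (sym (δ≡0⇒root ev))))
  meet-spec′ (suc h) {u} {v} u≢v eu ev (no _) (no ¬c) =
    lift (meet h (parentOf u) (parentOf v))
         (meet-spec h pu≢pv (suc-injective (trans (proj₂ below-u) eu))
                            (suc-injective (trans (proj₂ below-v) ev)))
    where
    below-u = parentOf-below (δ≡suc⇒non-root eu)
    below-v = parentOf-below (δ≡suc⇒non-root ev)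
    pu≢pv : parentOf u ≢ parentOf v
    pu≢pv e = ¬c (parentOf u , below-u , subst (Below v) (sym e) below-v)
    lift : ∀ m → Meets m (parentOf u) (parentOf v) → Meets (later m) u v
    lift (edge-at j) s = s
    lift (wedge-at j) s = s

  cycleLength : ℕ → Meeting → ℕ
  cycleLength ℓ (edge-at j) = suc (ℓ + 2 * j)
  cycleLength ℓ (wedge-at j) = suc (suc (ℓ + 2 * j))

  cycleLength-later : ∀ ℓ m → cycleLength (suc (suc ℓ)) m ≡ cycleLength ℓ (later m)
  cycleLength-later ℓ (edge-at j) = cong suc (2+m+2*n≡m+2*[1+n] ℓ j)
  cycleLength-later ℓ (wedge-at j) = cong (λ x → suc (suc x)) (2+m+2*n≡m+2*[1+n] ℓ j)

  Clear : Fin n → Fin n → Fin n → Set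
  Clear a b v = ∀ w → Adj G v w → δ w < δ a → ¬ Adj G w a × ¬ Adj G w b

  clear-above : ∀ {a b v} → δ a < δ v → Clear a b v
  clear-above a<v w vw w<a =
    ⊥-elim (<-irrefl refl (≤-trans a<v (≤-trans (δ-adj (adj-sym vw)) w<a)))

  -- interior-clear is what keeps the path induced when the parents of its ends are added.
  record Arch (ℓ : ℕ) : Set where
    field
      path           : InducedPath ℓ
      above          : ∀ i → i ≤ ℓ → δ (vertex path 0) ≤ δ (vertex path i)
      level          : δ (vertex path ℓ) ≡ δ (vertex path 0)
      interior-clear : ∀ i → 0 < i → i < ℓ →
                       Clear (vertex path 0) (vertex path ℓ) (vertex path i)

  start : ∀ {ℓ} → Arch ℓ → Fin n
  start Q = vertex (Arch.path Q) 0

  end : ∀ {ℓ} → Arch ℓ → Fin n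
  end {ℓ} Q = vertex (Arch.path Q) ℓ

  raised-arch : ∀ {ℓ} (P : InducedPath ℓ) → δ (vertex P ℓ) ≡ δ (vertex P 0) →
                (∀ i → 0 < i → i < ℓ → δ (vertex P 0) < δ (vertex P i)) → Arch ℓ
  raised-arch {ℓ} P level raised = record
    { path           = P
    ; above          = above
    ; level          = level
    ; interior-clear = λ i 0<i i<ℓ → clear-above (raised i 0<i i<ℓ) }
    where
    above : ∀ i → i ≤ ℓ → δ (vertex P 0) ≤ δ (vertex P i)
    above i i≤ℓ with start-inner-end i≤ℓ
    ... | inj₁ refl = ≤-refl
    ... | inj₂ (inj₁ (0<i , i<ℓ)) = <⇒≤ (raised i 0<i i<ℓ)
    ... | inj₂ (inj₂ refl) = ≤-reflexive (sym level)

  descend : ∀ {ℓ} (Q : Arch ℓ) → start Q ≢ r →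
            ¬ Adj G (start Q) (end Q) → ¬ CommonBelow (start Q) (end Q) →
            Σ[ Q′ ∈ Arch (suc (suc ℓ)) ] start Q′ ≡ parentOf (start Q) × end Q′ ≡ parentOf (end Q)
  descend {ℓ} Q A≢r A≁B no-common = Q′ , start≡ , end≡
    where
    open Arch Q
    f = vertex path
    A = f 0
    B = f ℓ
    pA = parentOf A
    pB = parentOf B
    below-A : Below A pA
    below-A = parentOf-below A≢r
    below-B : Below B pB
    below-B = parentOf-below (δ≡suc⇒non-root (trans level (sym (proj₂ below-A))))
    pA≢pB : pA ≢ pB
    pA≢pB e = no-common (pA , below-A , subst (Below B) (sym e) below-B)
    δpB≡δpA : δ pB ≡ δ pA
    δpB≡δpA = suc-injective (trans (proj₂ below-B) (trans level (sym (proj₂ below-A))))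
    pA-lower : ∀ i → i ≤ ℓ → δ pA < δ (f i)
    pA-lower i i≤ℓ = <-≤-trans (below-< below-A) (above i i≤ℓ)
    pB-lower : ∀ i → i ≤ ℓ → δ pB < δ (f i)
    pB-lower i i≤ℓ = subst (_< δ (f i)) (sym δpB≡δpA) (pA-lower i i≤ℓ)
    P₁ : InducedPath (suc ℓ)
    P₁ = prepend path pA (λ i i≤ℓ → ≢-sym (δ-<⇒≢ (pA-lower i i≤ℓ))) (below-adj below-A)
           (λ i 0<i i<ℓ a → proj₁ (interior-clear i 0<i i<ℓ pA (adj-sym a) (below-< below-A))
                                    (below-adj below-A))
           (λ _ → A≁B)
    P₁-fresh : ∀ i → i ≤ suc ℓ → vertex P₁ i ≢ pB
    P₁-fresh zero _ = pA≢pB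
    P₁-fresh (suc i) (s≤s i≤ℓ) = ≢-sym (δ-<⇒≢ (pB-lower i i≤ℓ))
    P₁-clear : ∀ i → 0 < i → i < suc ℓ → ¬ Adj G (vertex P₁ i) pB
    P₁-clear (suc zero) _ _ a = no-common (pB , adj-<⇒below a (pB-lower 0 z≤n) , below-B)
    P₁-clear (suc (suc i)) _ (s≤s i<ℓ) a =
      proj₂ (interior-clear (suc i) (s≤s z≤n) i<ℓ pB a (pB-lower 0 z≤n)) (below-adj below-B)
    P₂ : InducedPath (suc (suc ℓ))
    P₂ = append P₁ pB P₁-fresh (proj₁ below-B) P₁-clear
           (λ _ a → no-common (pA , below-A , adj-<⇒below (adj-sym a) (pA-lower ℓ ≤-refl)))
    v = vertex P₂
    inner≡ : ∀ {i} → i ≤ suc ℓ → v i ≡ vertex P₁ i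
    inner≡ = extend-≤ (vertex P₁) (suc ℓ) pB
    start≡ : v 0 ≡ pA
    start≡ = inner≡ z≤n
    end≡ : v (suc (suc ℓ)) ≡ pB
    end≡ = extend-end (vertex P₁) (suc ℓ) pB
    pA<inner : ∀ i → 0 < i → i < suc (suc ℓ) → δ pA < δ (v i)
    pA<inner (suc i) _ (s≤s i<1+ℓ) =
      subst (λ x → δ pA < δ x) (sym (inner≡ (s≤s (≤-pred i<1+ℓ)))) (pA-lower i (≤-pred i<1+ℓ))
    Q′ : Arch (suc (suc ℓ))
    Q′ = raised-arch P₂ (trans (cong δ end≡) (trans δpB≡δpA (cong δ (sym start≡))))
           λ i 0<i i< → subst (λ x → δ x < δ (v i)) (sym start≡) (pA<inner i 0<i i<)

  arch-cycle : ∀ h {ℓ} (Q : Arch ℓ) → δ (start Q) ≡ h → 2 ≤ ℓ →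
               InducedCycleOfLength (cycleLength ℓ (meet h (start Q) (end Q)))
  arch-cycle′ : ∀ h {ℓ} (Q : Arch ℓ) → δ (start Q) ≡ h → 2 ≤ ℓ →
                (a : Dec (Adj G (start Q) (end Q))) (c : Dec (CommonBelow (start Q) (end Q))) →
                InducedCycleOfLength (cycleLength ℓ (meet′ h (start Q) (end Q) a c))
  arch-cycle h Q eh 2≤ℓ = arch-cycle′ h Q eh 2≤ℓ (adj? _ _) (commonBelow? _ _)
  arch-cycle′ _ {ℓ} Q _ 2≤ℓ (yes a) _ =
    subst InducedCycleOfLength (cong suc (sym (+-identityʳ ℓ))) (close (Arch.path Q) 2≤ℓ a)
  arch-cycle′ _ {ℓ} Q _ 2≤ℓ (no A≁B) (yes (w , below-A , below-B)) =
    subst InducedCycleOfLength (cong (λ x → suc (suc x)) (sym (+-identityʳ ℓ)))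
      (close P (m≤n⇒m≤1+n 2≤ℓ)
        (subst₂ (Adj G) (sym (extend-≤ f ℓ w z≤n)) (sym (extend-end f ℓ w)) (proj₁ below-A)))
    where
    open Arch Q
    f = vertex path
    w-lower : ∀ i → i ≤ ℓ → δ w < δ (f i)
    w-lower i i≤ℓ = <-≤-trans (below-< below-A) (above i i≤ℓ)
    P : InducedPath (suc ℓ)
    P = append path w (λ i i≤ℓ → ≢-sym (δ-<⇒≢ (w-lower i i≤ℓ))) (proj₁ below-B)
          (λ i 0<i i<ℓ a → proj₁ (interior-clear i 0<i i<ℓ w a (below-< below-A)) (below-adj below-A))
          (λ _ → A≁B)
  arch-cycle′ zero {ℓ} Q eh 2≤ℓ (no _) (no _) =
    ⊥-elim (distinct path 0 ℓ (<-≤-trans (s≤s z≤n) 2≤ℓ) ≤-refl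
             (trans (δ≡0⇒root eh) (sym (δ≡0⇒root (trans level eh)))))
    where open Arch Q
  arch-cycle′ (suc h) {ℓ} Q eh 2≤ℓ (no A≁B) (no no-common) =
    subst InducedCycleOfLength (cycleLength-later ℓ (meet h pA pB))
      (subst₂ (λ u v → InducedCycleOfLength (cycleLength (suc (suc ℓ)) (meet h u v))) start≡ end≡
        (arch-cycle h Q′ (trans (cong δ start≡) (trans (parentOf-δ (start Q)) (cong (_∸ 1) eh)))
                     (m≤n⇒m≤1+n (m≤n⇒m≤1+n 2≤ℓ))))
    where
    pA = parentOf (start Q)
    pB = parentOf (end Q)
    descended = descend Q (δ≡suc⇒non-root eh) A≁B no-common
    Q′ = proj₁ descended
    start≡ : start Q′ ≡ pA
    start≡ = proj₁ (proj₂ descended)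
    end≡ : end Q′ ≡ pB
    end≡ = proj₂ (proj₂ descended)

  arch-meet : ∀ {ℓ} → Arch ℓ → Meeting
  arch-meet Q = meet (δ (start Q)) (start Q) (end Q)

  arch-meets : ∀ {ℓ} (Q : Arch ℓ) → 0 < ℓ → Meets (arch-meet Q) (start Q) (end Q)
  arch-meets Q 0<ℓ = meet-spec _ (distinct path 0 _ 0<ℓ ≤-refl) refl level
    where open Arch Q

  arch₂ : ∀ {a b c} → a ≢ b → a ≢ c → b ≢ c → Adj G a b → Adj G b c →
          δ c ≡ δ a → δ a ≤ δ b → Clear a c b → Arch 2
  arch₂ a≢b a≢c b≢c ab bc c~a a≤b clear-b = record
    { path           = path₂ a≢b a≢c b≢c ab bc
    ; above          = λ { 0 _ → ≤-refl ; 1 _ → a≤b ; (suc (suc _)) _ → ≤-reflexive (sym c~a) }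
    ; level          = c~a
    ; interior-clear = λ { 1 _ _ → clear-b ; (suc (suc _)) _ (s≤s (s≤s ())) } }

  arch₃ : ∀ {a b c d} → a ≢ b → a ≢ c → a ≢ d → b ≢ c → b ≢ d → c ≢ d →
          Adj G a b → Adj G b c → Adj G c d → ¬ Adj G a c → ¬ Adj G b d →
          δ d ≡ δ a → δ a ≤ δ b → δ a ≤ δ c → Clear a d b → Clear a d c → Arch 3
  arch₃ a≢b a≢c a≢d b≢c b≢d c≢d ab bc cd a≁c b≁d d~a a≤b a≤c clear-b clear-c = record
    { path           = path₃ a≢b a≢c a≢d b≢c b≢d c≢d ab bc cd a≁c b≁d
    ; above          = λ { 0 _ → ≤-refl ; 1 _ → a≤b ; 2 _ → a≤c
                         ; (suc (suc (suc _))) _ → ≤-reflexive (sym d~a) }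
    ; level          = d~a
    ; interior-clear = λ { 1 _ _ → clear-b ; 2 _ _ → clear-c
                         ; (suc (suc (suc _))) _ (s≤s (s≤s (s≤s ()))) } }

  arch₄ : ∀ {a b c d e} → a ≢ b → a ≢ c → a ≢ d → a ≢ e → b ≢ c → b ≢ d → b ≢ e →
          c ≢ d → c ≢ e → d ≢ e →
          Adj G a b → Adj G b c → Adj G c d → Adj G d e →
          ¬ Adj G a c → ¬ Adj G a d → ¬ Adj G b d → ¬ Adj G b e → ¬ Adj G c e →
          δ e ≡ δ a → δ a ≤ δ b → δ a ≤ δ c → δ a ≤ δ d →
          Clear a e b → Clear a e c → Clear a e d → Arch 4
  arch₄ a≢b a≢c a≢d a≢e b≢c b≢d b≢e c≢d c≢e d≢e ab bc cd de a≁c a≁d b≁d b≁e c≁e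
        e~a a≤b a≤c a≤d clear-b clear-c clear-d = record
    { path           = path₄ a≢b a≢c a≢d a≢e b≢c b≢d b≢e c≢d c≢e d≢e ab bc cd de
                               a≁c a≁d b≁d b≁e c≁e
    ; above          = λ { 0 _ → ≤-refl ; 1 _ → a≤b ; 2 _ → a≤c ; 3 _ → a≤d
                         ; (suc (suc (suc (suc _)))) _ → ≤-reflexive (sym e~a) }
    ; level          = e~a
    ; interior-clear = λ { 1 _ _ → clear-b ; 2 _ _ → clear-c ; 3 _ _ → clear-d
                         ; (suc (suc (suc (suc _)))) _ (s≤s (s≤s (s≤s (s≤s ())))) } }

module SCBreadthFirst (K : ℕ) {n : ℕ} (G : Graph n) (conn : Connected G)
                       (sc : SC (2 * suc (suc K) + 1) G) (r : Fin n) (T : BFSTree G r) where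

  open GraphBasics G
  open Paths G
  open BreadthFirst G conn r T

  k : ℕ
  k = suc (suc K)

  odd-cycle : ∀ {a} → InducedCycleOfLength (suc (2 * a)) → a ≡ k
  odd-cycle (m , C , e) = *-cancelˡ-≡ _ _ 2 (suc-injective (trans (sym e) (trans (sc m C) (+-comm (2 * k) 1))))

  even-cycle : ∀ {a} → ¬ InducedCycleOfLength (2 * a)
  even-cycle {a} (m , C , e) = even≢odd a k (trans (sym e) (trans (sc m C) (+-comm (2 * k) 1)))

  no-triangle : ∀ {a b c} → Adj G a b → Adj G b c → ¬ Adj G a c
  no-triangle ab bc ac
    with odd-cycle {1} (triangle (adj-irrefl ab) (adj-irrefl ac) (adj-irrefl bc) ab bc ac)
  ... | ()

  no-square : ∀ {a b c d} → a ≢ c → b ≢ d →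
              Adj G a b → Adj G b c → Adj G c d → Adj G a d → ¬ Adj G a c → ¬ Adj G b d → ⊥
  no-square a≢c b≢d ab bc cd ad a≁c b≁d = even-cycle {2}
    (square (adj-irrefl ab) a≢c (adj-irrefl ad) (adj-irrefl bc) b≢d (adj-irrefl cd) ab bc cd ad a≁c b≁d)

  arch₂-meet : (Q : Arch 2) → arch-meet Q ≡ edge-at (suc K)
  arch₂-meet Q = from-length (arch-meet Q) (arch-cycle _ Q refl ≤-refl)
    where
    from-length : ∀ m → InducedCycleOfLength (cycleLength 2 m) → m ≡ edge-at (suc K)
    from-length (edge-at j) C =
      cong edge-at (suc-injective (odd-cycle (subst InducedCycleOfLength (cong suc (sym (*-suc 2 j))) C)))
    from-length (wedge-at j) C =
      ⊥-elim (even-cycle {2 + j} (subst InducedCycleOfLength (sym (*-distribˡ-+ 2 2 j)) C))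

  arch₃-meet : (Q : Arch 3) → arch-meet Q ≡ wedge-at K
  arch₃-meet Q = from-length (arch-meet Q) (arch-cycle _ Q refl (s≤s (s≤s z≤n)))
    where
    from-length : ∀ m → InducedCycleOfLength (cycleLength 3 m) → m ≡ wedge-at K
    from-length (edge-at j) C =
      ⊥-elim (even-cycle {2 + j} (subst InducedCycleOfLength (sym (*-distribˡ-+ 2 2 j)) C))
    from-length (wedge-at j) C = cong wedge-at (suc-injective (suc-injective
      (odd-cycle {2 + j} (subst InducedCycleOfLength (cong suc (sym (*-distribˡ-+ 2 2 j))) C))))

  arch₄-meet : (Q : Arch 4) → arch-meet Q ≡ edge-at K
  arch₄-meet Q = from-length (arch-meet Q) (arch-cycle _ Q refl (s≤s (s≤s z≤n)))
    where
    from-length : ∀ m → InducedCycleOfLength (cycleLength 4 m) → m ≡ edge-at K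
    from-length (edge-at j) C = cong edge-at (suc-injective (suc-injective
      (odd-cycle {2 + j} (subst InducedCycleOfLength (cong suc (sym (*-distribˡ-+ 2 2 j))) C))))
    from-length (wedge-at j) C =
      ⊥-elim (even-cycle {3 + j} (subst InducedCycleOfLength (sym (*-distribˡ-+ 2 3 j)) C))

  arch₂-meets : (Q : Arch 2) → Meets (edge-at (suc K)) (start Q) (end Q)
  arch₂-meets Q = subst (λ m → Meets m (start Q) (end Q)) (arch₂-meet Q) (arch-meets Q (s≤s z≤n))

  arch₃-meets : (Q : Arch 3) → Meets (wedge-at K) (start Q) (end Q)
  arch₃-meets Q = subst (λ m → Meets m (start Q) (end Q)) (arch₃-meet Q) (arch-meets Q (s≤s z≤n))

  arch₄-meets : (Q : Arch 4) → Meets (edge-at K) (start Q) (end Q)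
  arch₄-meets Q = subst (λ m → Meets m (start Q) (end Q)) (arch₄-meet Q) (arch-meets Q (s≤s z≤n))

  -- An Arch 2 and an Arch 3 with the same ends would meet after different numbers of steps.
  arch₂-arch₃-ends : (Q₂ : Arch 2) (Q₃ : Arch 3) → start Q₂ ≡ start Q₃ → end Q₂ ≢ end Q₃
  arch₂-arch₃-ends Q₂ Q₃ s e
    with trans (sym (arch₂-meet Q₂)) (trans (cong₂ (λ u v → meet (δ u) u v) s e) (arch₃-meet Q₃))
  ... | ()

  Flat : Fin n → Fin n → Set
  Flat x y = Adj G x y × δ y ≡ δ x

  Down : Fin n → Fin n → Set
  Down x y = Below x y × TwoBelow x

  Up : Fin n → Fin n → Set
  Up x y = Below y x × TwoBelow y

  flat-sym : ∀ {x y} → Flat x y → Flat y x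
  flat-sym (xy , y~x) = adj-sym xy , sym y~x

  flat-non-root : ∀ {x y} → Flat x y → x ≢ r
  flat-non-root (xy , y~x) refl = adj-irrefl xy (sym (δ≡0⇒root (trans y~x δ-root)))

  flat-no-common-below : ∀ {x y} → Flat x y → ¬ CommonBelow x y
  flat-no-common-below (xy , _) (w , below-x , below-y) = no-triangle xy (proj₁ below-y) (proj₁ below-x)

  siblings-not-adj : ∀ {z x c} → Below z x → Below z c → ¬ Adj G x c
  siblings-not-adj below-x below-c = no-triangle (below-adj below-x) (proj₁ below-c)

  siblings-meet : ∀ {x a b} → a ≢ b → Below x a → Below x b → Meets (edge-at (suc K)) a b
  siblings-meet a≢b below-a below-b = arch₂-meets
    (arch₂ (below-≢ below-a) a≢b (≢-sym (below-≢ below-b)) (below-adj below-a) (proj₁ below-b)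
           (sym (below-δ below-a below-b)) (<⇒≤ (below-< below-a)) (clear-above (below-< below-a)))

  no-three-below : ∀ {x a b c} → a ≢ b → a ≢ c → b ≢ c → Below x a → Below x b → Below x c → ⊥
  no-three-below a≢b a≢c b≢c below-a below-b below-c =
    no-triangle (siblings-meet a≢b below-a below-b) (siblings-meet b≢c below-b below-c)
                (siblings-meet a≢c below-a below-c)

  below-one-of : ∀ {x a b v} → a ≢ b → Below x a → Below x b → Below x v → v ≡ a ⊎ v ≡ b
  below-one-of {_} {a} {b} {v} a≢b below-a below-b below-v with v ≟ᶠ a | v ≟ᶠ b
  ... | yes v≡a | _ = inj₁ v≡a
  ... | no _ | yes v≡b = inj₂ v≡b
  ... | no v≢a | no v≢b =
    ⊥-elim (no-three-below a≢b (≢-sym v≢a) (≢-sym v≢b) below-a below-b below-v)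

  -- Otherwise x z c v would be an induced square.
  sibling-not-adj-below : ∀ {z x c v} → Below z x → Below z c → x ≢ c → Below x v → ¬ Adj G c v
  sibling-not-adj-below below-x below-c x≢c below-v cv =
    no-square x≢c (≢-sym (δ-<⇒≢ (<-trans (below-< below-v) (below-< below-x))))
      (below-adj below-x) (proj₁ below-c) cv (proj₁ below-v) (siblings-not-adj below-x below-c)
      (λ zv → far-apart (subst (_< _) (sym (proj₂ below-v)) (below-< below-x)) (adj-sym zv))

  flat-arch-meets : ∀ {x z a} → Flat x z → ¬ CommonBelow x z → Below x a →
                    Meets (wedge-at K) a (parentOf z)
  flat-arch-meets {x} {z} {a} (xz , z~x) no-common below-a = arch₃-meets
    (arch₃ (below-≢ below-a) (δ-<⇒≢ a<z) a≢pz (adj-irrefl xz) (≢-sym (δ-<⇒≢ pz<x))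
           (≢-sym (below-≢ below-pz)) (below-adj below-a) xz (proj₁ below-pz)
           (λ az → no-common (a , below-a , adj-sym az , trans (proj₂ below-a) (sym z~x)))
           (λ x-pz → no-common (pz , (x-pz , trans (proj₂ below-pz) z~x) , below-pz))
           pz~a (<⇒≤ (below-< below-a)) (<⇒≤ a<z)
           (clear-above (below-< below-a)) (clear-above a<z))
    where
    pz = parentOf z
    below-pz : Below z pz
    below-pz = parentOf-below (δ≡suc⇒non-root (trans z~x (sym (proj₂ below-a))))
    a<z : δ a < δ z
    a<z = subst (δ a <_) (sym z~x) (below-< below-a)
    pz~a : δ pz ≡ δ a
    pz~a = suc-injective (trans (proj₂ below-pz) (trans z~x (sym (proj₂ below-a))))
    pz<x : δ pz < δ x
    pz<x = subst (_< δ x) (sym pz~a) (below-< below-a)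
    a≢pz : a ≢ pz
    a≢pz e = no-common (a , below-a , subst (Below z) (sym e) below-pz)

  -- Each field excludes one way, other than two non-tree edges going down, in which a
  -- vertex x could lie on two non-tree edges; M bounds the depth of the deepest vertex.
  record Separated (M : ℕ) : Set where
    field
      down-flat : ∀ x y z → δ x ≤ M → Down x y → Flat x z → ⊥
      down-up   : ∀ x y z → δ z ≤ M → Down x y → Up x z → ⊥
      flat-flat : ∀ x y z → δ x ≤ M → Flat x y → Flat x z → y ≢ z → ⊥
      flat-up   : ∀ x y z → δ z ≤ M → Flat x y → Up x z → ⊥
      up-up     : ∀ x y z → δ y ≤ M → Up x y → Up x z → y ≢ z → ⊥

  below-depth : ∀ {M u v} → δ u < δ v → δ v ≤ suc M → δ u ≤ M
  below-depth u<v v≤1+M = ≤-pred (≤-trans u<v v≤1+M)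

  ancestor-depth : ∀ j {M u v} → δ u < δ v → δ v ≤ suc M → δ (ancestor j u) ≤ M
  ancestor-depth j {u = u} u<v v≤1+M = below-depth (≤-<-trans (ancestor-δ-≤ j u) u<v) v≤1+M

  -- With p, q the lower neighbours of x, the ancestors P₀, Q₀ of p, q are flat neighbours,
  -- and the ancestors of p and of q after K steps each share a lower neighbour with Z;
  -- this gives a vertex with a second lower neighbour over P₀ Q₀, or a triangle.
  down-flat-step : ∀ M → Separated M → ∀ x y z → δ x ≤ suc M → Down x y → Flat x z → ⊥
  down-flat-step M ih x y z x≤1+M (below-y , two-x) flat-xz
    with commonBelow? x z
  ... | yes common = flat-no-common-below flat-xz common
  ... | no no-common = from-common (proj₁ (flat-arch-meets flat-xz no-common below-p))
    where
    open Separated ih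
    p = parentOf x
    below-p = parentOf-below (below-non-root below-y)
    other = other-below p two-x
    q = proj₁ other
    below-q = proj₁ (proj₂ other)
    P₀ = ancestor (suc K) p
    Q₀ = ancestor (suc K) q
    X = ancestor K p
    Z = ancestor K (parentOf z)
    flat-P₀Q₀ : Flat P₀ Q₀
    flat-P₀Q₀ = siblings-meet (≢-sym (proj₂ (proj₂ other))) below-p below-q ,
                ancestor-δ-≡ (suc K) (below-δ below-q below-p)
    below-pz = parentOf-below (δ≡suc⇒non-root (trans (proj₂ flat-xz) (sym (proj₂ below-p))))
    Z-only-P₀ : Below Z P₀ → ∀ v → Below Z v → v ≡ P₀
    Z-only-P₀ below-P₀ v below-v with v ≟ᶠ P₀
    ... | yes v≡P₀ = v≡P₀
    ... | no v≢P₀ = ⊥-elim (flat-up P₀ Q₀ Z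
          (ancestor-depth K (below-< below-pz) (subst (_≤ suc M) (sym (proj₂ flat-xz)) x≤1+M))
          flat-P₀Q₀ (below-P₀ , v , P₀ , v≢P₀ , below-v , below-P₀))
    from-common : CommonBelow X Z → ⊥
    from-common (w , below-w , Z-below-w) with w ≟ᶠ P₀
    ... | no w≢P₀ = flat-up P₀ Q₀ X (ancestor-depth K (below-< below-p) x≤1+M) flat-P₀Q₀
                      (below-P₀ , w , P₀ , w≢P₀ , below-w , below-P₀)
      where below-P₀ = ancestor-below K (below-non-root below-w)
    ... | yes refl =
      no-triangle (proj₁ Q₁-below-Q₀) (adj-sym (proj₁ flat-P₀Q₀)) (proj₁ Q₁-below-P₀)
      where
      Q₁ = ancestor K q
      common-Q₁Z = proj₁ (flat-arch-meets flat-xz no-common below-q)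
      Q₁-below-P₀ : Below Q₁ P₀
      Q₁-below-P₀ = subst (Below Q₁) (Z-only-P₀ Z-below-w _ (proj₂ (proj₂ common-Q₁Z)))
                                      (proj₁ (proj₂ common-Q₁Z))
      Q₁-below-Q₀ : Below Q₁ Q₀
      Q₁-below-Q₀ = ancestor-below K (below-non-root Q₁-below-P₀)

  down-up-arch-meets : ∀ {x z p q c} → q ≢ p → Below x p → Below x q →
                       Below z x → Below z c → c ≢ x →
                       Meets (edge-at K) q (parentOf c)
  down-up-arch-meets {x} {z} {p} {q} {c} q≢p below-p below-q z-below-x below-c c≢x = arch₄-meets
    (arch₄ (below-≢ below-q) (δ-<⇒≢ q<z) (δ-<⇒≢ q<c) q≢c′
           (below-≢ z-below-x) (≢-sym c≢x) (≢-sym (δ-<⇒≢ c′<x))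
           (≢-sym (below-≢ below-c)) (≢-sym (δ-<⇒≢ (<-trans c′<x (below-< z-below-x))))
           (≢-sym (below-≢ below-c′))
           (below-adj below-q) (below-adj z-below-x) (proj₁ below-c) (proj₁ below-c′)
           (far-apart (subst (_< δ z) (sym (proj₂ below-q)) (below-< z-below-x)))
           (λ a → c-not-below-x below-q (adj-sym a))
           (siblings-not-adj z-below-x below-c) x≁c′
           (λ a → far-apart (subst (_< δ z) (trans (sym (proj₂ below-q)) (cong suc (sym c′~q)))
                                    (below-< z-below-x)) (adj-sym a))
           c′~q (<⇒≤ q<x) (<⇒≤ q<z) (<⇒≤ q<c)
           (clear-above q<x) (clear-above q<z) (clear-above q<c))
    where
    c~x : δ c ≡ δ x
    c~x = below-δ below-c z-below-x
    c′ = parentOf c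
    below-c′ = parentOf-below (δ≡suc⇒non-root (trans c~x (sym (proj₂ below-q))))
    c′~q : δ c′ ≡ δ q
    c′~q = suc-injective (trans (proj₂ below-c′) (trans c~x (sym (proj₂ below-q))))
    c-not-below-x : ∀ {v} → Below x v → ¬ Adj G c v
    c-not-below-x = sibling-not-adj-below z-below-x below-c (≢-sym c≢x)
    q<x = below-< below-q
    q<z = <-trans q<x (below-< z-below-x)
    q<c = subst (δ q <_) (sym c~x) q<x
    c′<x = subst (_< δ x) (sym c′~q) q<x
    q≢c′ : q ≢ c′
    q≢c′ e = c-not-below-x below-q (subst (Adj G c) (sym e) (proj₁ below-c′))
    x≁c′ : ¬ Adj G x c′
    x≁c′ a with below-one-of (≢-sym q≢p) below-p below-q (a , trans (cong suc c′~q) (proj₂ below-q))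
    ... | inj₁ c′≡p = c-not-below-x below-p (subst (Adj G c) c′≡p (proj₁ below-c′))
    ... | inj₂ c′≡q = q≢c′ (sym c′≡q)

  -- With p, q the lower neighbours of x and c the other lower neighbour of z, the
  -- ancestor at height K of the parent c′ of c is flat-adjacent to those of both p and q.
  down-up-step : ∀ M → Separated M → ∀ x y z → δ z ≤ suc M → Down x y → Up x z → ⊥
  down-up-step M ih x y z z≤1+M (below-y , two-x) (z-below-x , two-z) =
    Separated.flat-flat ih (ancestor K c′) (ancestor K p) (ancestor K q)
      (ancestor-depth K c′<z z≤1+M)
      (adj-sym (siblings-meet (≢-sym c≢x) z-below-x below-c) , ancestor-δ-≡ K (sym c′~p))
      (adj-sym (down-up-arch-meets q≢p below-p below-q z-below-x below-c c≢x) ,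
       ancestor-δ-≡ K (sym (trans c′~p (below-δ below-p below-q))))
      (ancestor-≢ K (adj-irrefl (siblings-meet (≢-sym q≢p) below-p below-q)))
    where
    p = parentOf x
    below-p = parentOf-below (below-non-root below-y)
    other-x = other-below p two-x
    q = proj₁ other-x
    below-q = proj₁ (proj₂ other-x)
    q≢p = proj₂ (proj₂ other-x)
    other-z = other-below x two-z
    c = proj₁ other-z
    below-c = proj₁ (proj₂ other-z)
    c≢x = proj₂ (proj₂ other-z)
    c′ = parentOf c
    c′~p : δ c′ ≡ δ p
    c′~p = trans (parentOf-δ c) (trans (cong (_∸ 1) (below-δ below-c z-below-x)) (sym (parentOf-δ x)))
    c′<z : δ c′ < δ z
    c′<z = subst (_< δ z) (sym c′~p) (<-trans (below-< below-p) (below-< z-below-x))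

  unique-below-of-flat : ∀ {M} → Separated M → ∀ {A B w v} → δ A ≤ M → Flat A B →
                         Below A w → Below A v → v ≡ w
  unique-below-of-flat ih {A} {B} {w} {v} A≤M flat below-w below-v with v ≟ᶠ w
  ... | yes v≡w = v≡w
  ... | no v≢w = ⊥-elim (Separated.down-flat ih A v B A≤M (below-v , v , w , v≢w , below-v , below-w) flat)

  -- The ancestors Y₀, Z₀ of y, z are adjacent, and each has a common lower neighbour
  -- (w₁, w₂) with the ancestor X₀ of x.  If w₁ = w₂ there is a triangle; otherwise the
  -- arches w₁ X₀ w₂ and w₁ Y₀ Z₀ w₂ have the same ends.
  flat-flat-step : ∀ M → Separated M → ∀ x y z → δ x ≤ suc M → Flat x y → Flat x z → y ≢ z → ⊥
  flat-flat-step M ih x y z x≤1+M flat-xy flat-xz y≢z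
    with commonBelow? x y | commonBelow? x z
  ... | yes common | _ = flat-no-common-below flat-xy common
  ... | no _ | yes common = flat-no-common-below flat-xz common
  ... | no no-common-y | no no-common-z =
    from-commons (proj₁ (flat-arch-meets flat-xy no-common-y below-p))
                 (proj₁ (flat-arch-meets flat-xz no-common-z below-p))
    where
    xy = proj₁ flat-xy
    xz = proj₁ flat-xz
    below-p = parentOf-below (flat-non-root flat-xy)
    X₀ = ancestor (suc K) x
    Y₀ = ancestor (suc K) y
    Z₀ = ancestor (suc K) z
    Y₀Z₀ : Adj G Y₀ Z₀
    Y₀Z₀ = arch₂-meets (arch₂ (≢-sym (adj-irrefl xy)) y≢z (adj-irrefl xz) (adj-sym xy) xz
             (trans (proj₂ flat-xz) (sym (proj₂ flat-xy))) (≤-reflexive (proj₂ flat-xy))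
             λ w xw _ → (λ wy → no-triangle (adj-sym xw) xy wy)
                      , (λ wz → no-triangle (adj-sym xw) xz wz))
    Z₀~Y₀ : δ Z₀ ≡ δ Y₀
    Z₀~Y₀ = ancestor-δ-≡ (suc K) (trans (proj₂ flat-xz) (sym (proj₂ flat-xy)))
    ancestor-≤M : ∀ {v} → Flat x v → δ (ancestor (suc K) v) ≤ M
    ancestor-≤M flat = below-depth (ancestor-< K (flat-non-root (flat-sym flat)))
                                   (≤-trans (≤-reflexive (proj₂ flat)) x≤1+M)
    from-commons : CommonBelow X₀ Y₀ → CommonBelow X₀ Z₀ → ⊥
    from-commons (w₁ , X₀-below-w₁ , Y₀-below-w₁) (w₂ , X₀-below-w₂ , Z₀-below-w₂)
      with w₁ ≟ᶠ w₂
    ... | yes refl = no-triangle (below-adj Y₀-below-w₁) Y₀Z₀ (below-adj Z₀-below-w₂)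
    ... | no w₁≢w₂ = arch₂-arch₃-ends arch-X₀ arch-Y₀Z₀ refl refl
      where
      w₂~w₁ : δ w₂ ≡ δ w₁
      w₂~w₁ = below-δ X₀-below-w₂ X₀-below-w₁
      w₁<Z₀ : δ w₁ < δ Z₀
      w₁<Z₀ = subst (δ w₁ <_) (sym Z₀~Y₀) (below-< Y₀-below-w₁)
      arch-X₀ : Arch 2
      arch-X₀ = arch₂ (below-≢ X₀-below-w₁) w₁≢w₂ (≢-sym (below-≢ X₀-below-w₂))
                  (below-adj X₀-below-w₁) (proj₁ X₀-below-w₂) w₂~w₁
                  (<⇒≤ (below-< X₀-below-w₁)) (clear-above (below-< X₀-below-w₁))
      arch-Y₀Z₀ : Arch 3
      arch-Y₀Z₀ = arch₃ (below-≢ Y₀-below-w₁) (δ-<⇒≢ w₁<Z₀) w₁≢w₂ (adj-irrefl Y₀Z₀)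
                    (≢-sym (δ-<⇒≢ (subst (_< δ Y₀) (sym w₂~w₁) (below-< Y₀-below-w₁))))
                    (≢-sym (below-≢ Z₀-below-w₂))
                    (below-adj Y₀-below-w₁) Y₀Z₀ (proj₁ Z₀-below-w₂)
                    (λ a → w₁≢w₂ (unique-below-of-flat ih (ancestor-≤M flat-xz)
                                    (adj-sym Y₀Z₀ , sym Z₀~Y₀) Z₀-below-w₂
                                    (adj-sym a , trans (cong suc (sym w₂~w₁)) (proj₂ Z₀-below-w₂))))
                    (λ a → w₁≢w₂ (sym (unique-below-of-flat ih (ancestor-≤M flat-xy)
                                    (Y₀Z₀ , Z₀~Y₀) Y₀-below-w₁
                                    (a , trans (cong suc w₂~w₁) (proj₂ Y₀-below-w₁)))))
                    w₂~w₁ (<⇒≤ (below-< Y₀-below-w₁)) (<⇒≤ w₁<Z₀)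
                    (clear-above (below-< Y₀-below-w₁)) (clear-above w₁<Z₀)

  flat-up-arch-meets : ∀ {x y z c} → Flat x y → Below z x → Below z c → c ≢ x →
                       Meets (wedge-at K) y c
  flat-up-arch-meets {x} {y} {z} {c} (xy , y~x) z-below-x below-c c≢x = arch₃-meets
    (arch₃ (≢-sym (adj-irrefl xy)) (δ-<⇒≢ y<z) y≢c (below-≢ z-below-x) (≢-sym c≢x)
           (≢-sym (below-≢ below-c)) (adj-sym xy) (below-adj z-below-x) (proj₁ below-c) y≁z
           (siblings-not-adj z-below-x below-c)
           (trans (below-δ below-c z-below-x) (sym y~x)) (≤-reflexive y~x) (<⇒≤ y<z)
           (λ w xw w<y → (λ wy → no-triangle (adj-sym xw) xy wy)
                       , (λ wc → sibling-not-adj-below z-below-x below-c (≢-sym c≢x)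
                                   (adj-<⇒below xw (subst (δ w <_) y~x w<y)) (adj-sym wc)))
           (clear-above y<z))
    where
    y<z : δ y < δ z
    y<z = subst (_< δ z) (sym y~x) (below-< z-below-x)
    y≢c : y ≢ c
    y≢c refl = no-triangle xy (below-adj below-c) (below-adj z-below-x)
    y≁z : ¬ Adj G y z
    y≁z a with below-one-of (≢-sym c≢x) z-below-x below-c
                 (adj-sym a , trans (cong suc y~x) (proj₂ z-below-x))
    ... | inj₁ y≡x = adj-irrefl xy (sym y≡x)
    ... | inj₂ y≡c = y≢c y≡c

  -- With c the other lower neighbour of z, C₀ is a flat neighbour of X₀, and the ancestors
  -- of y and c after K steps share a lower neighbour; it must be C₀, which is then a second
  -- lower neighbour of the ancestor of y.
  flat-up-step : ∀ M → Separated M → ∀ x y z → δ z ≤ suc M → Flat x y → Up x z → ⊥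
  flat-up-step M ih x y z z≤1+M flat-xy (z-below-x , two-z) with commonBelow? x y
  ... | yes common = flat-no-common-below flat-xy common
  ... | no no-common = from-common (proj₁ (flat-up-arch-meets flat-xy z-below-x below-c c≢x))
    where
    open Separated ih
    other-z = other-below x two-z
    c = proj₁ other-z
    below-c = proj₁ (proj₂ other-z)
    c≢x = proj₂ (proj₂ other-z)
    X₀ = ancestor (suc K) x
    Y₀ = ancestor (suc K) y
    C₀ = ancestor (suc K) c
    flat-C₀X₀ : Flat C₀ X₀
    flat-C₀X₀ = adj-sym (siblings-meet (≢-sym c≢x) z-below-x below-c) ,
                ancestor-δ-≡ (suc K) (below-δ z-below-x below-c)
    X₀≁Y₀ : ¬ Adj G X₀ Y₀
    X₀≁Y₀ = proj₂ (flat-arch-meets flat-xy no-common (parentOf-below (flat-non-root flat-xy)))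
    y<z : δ y < δ z
    y<z = subst (_< δ z) (sym (proj₂ flat-xy)) (below-< z-below-x)
    from-common : CommonBelow (ancestor K y) (ancestor K c) → ⊥
    from-common (w , Y₁-below-w , C₁-below-w) with w ≟ᶠ C₀
    ... | no w≢C₀ = flat-up C₀ X₀ (ancestor K c)
                      (ancestor-depth K (below-< below-c) z≤1+M) flat-C₀X₀
                      (C₁-below-C₀ , w , C₀ , w≢C₀ , C₁-below-w , C₁-below-C₀)
      where C₁-below-C₀ = ancestor-below K (below-non-root C₁-below-w)
    ... | yes refl with C₀ ≟ᶠ Y₀
    ...   | yes C₀≡Y₀ = X₀≁Y₀ (subst (Adj G X₀) C₀≡Y₀ (adj-sym (proj₁ flat-C₀X₀)))
    ...   | no C₀≢Y₀ = flat-up C₀ X₀ (ancestor K y) (ancestor-depth K y<z z≤1+M) flat-C₀X₀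
                         (Y₁-below-w , C₀ , Y₀ , C₀≢Y₀ , Y₁-below-w ,
                          ancestor-below K (below-non-root Y₁-below-w))

  up-up-arch-meets : ∀ {x y z c₁ c₂} → y ≢ z → c₁ ≢ c₂ →
                     Below y x → Below y c₁ → c₁ ≢ x → Below z x → Below z c₂ → c₂ ≢ x →
                     Meets (edge-at K) c₁ c₂
  up-up-arch-meets {x} {y} {z} {c₁} {c₂} y≢z c₁≢c₂
                   y-below-x y-below-c₁ c₁≢x z-below-x z-below-c₂ c₂≢x =
    arch₄-meets
      (arch₄ (below-≢ y-below-c₁) c₁≢x (δ-<⇒≢ c₁<z) c₁≢c₂
             (≢-sym (below-≢ y-below-x)) y≢z (≢-sym (δ-<⇒≢ c₂<y))
             (below-≢ z-below-x) (≢-sym c₂≢x) (≢-sym (below-≢ z-below-c₂))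
             (below-adj y-below-c₁) (proj₁ y-below-x) (below-adj z-below-x) (proj₁ z-below-c₂)
             (λ a → siblings-not-adj y-below-x y-below-c₁ (adj-sym a)) c₁≁z
             (no-triangle (proj₁ y-below-x) (below-adj z-below-x)) y≁c₂
             (siblings-not-adj z-below-x z-below-c₂)
             (trans c₂~x (sym c₁~x)) (<⇒≤ c₁<y) (≤-reflexive c₁~x) (<⇒≤ c₁<z)
             (clear-above c₁<y) clear-x (clear-above c₁<z))
    where
    c₁~x = below-δ y-below-c₁ y-below-x
    c₂~x = below-δ z-below-c₂ z-below-x
    c₁<y = below-< y-below-c₁
    c₁<z = subst (_< δ z) (sym c₁~x) (below-< z-below-x)
    c₂<y = subst (_< δ y) (sym c₂~x) (below-< y-below-x)
    c₁≁z : ¬ Adj G c₁ z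
    c₁≁z a with below-one-of (≢-sym c₂≢x) z-below-x z-below-c₂
                  (adj-sym a , trans (cong suc c₁~x) (proj₂ z-below-x))
    ... | inj₁ c₁≡x = c₁≢x c₁≡x
    ... | inj₂ c₁≡c₂ = c₁≢c₂ c₁≡c₂
    y≁c₂ : ¬ Adj G y c₂
    y≁c₂ a with below-one-of (≢-sym c₁≢x) y-below-x y-below-c₁
                  (a , trans (cong suc c₂~x) (proj₂ y-below-x))
    ... | inj₁ c₂≡x = c₂≢x c₂≡x
    ... | inj₂ c₂≡c₁ = c₁≢c₂ (sym c₂≡c₁)
    clear-x : Clear c₁ c₂ x
    clear-x w xw w<c₁ =
      (λ wc₁ → sibling-not-adj-below y-below-x y-below-c₁ (≢-sym c₁≢x) x-below-w (adj-sym wc₁)) ,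
      (λ wc₂ → sibling-not-adj-below z-below-x z-below-c₂ (≢-sym c₂≢x) x-below-w (adj-sym wc₂))
      where x-below-w = adj-<⇒below xw (subst (δ w <_) c₁~x w<c₁)

  -- If c₁ = c₂ then x y c₁ z is a square.  Otherwise the ancestors A, B of c₁, c₂ are
  -- flat neighbours of the ancestor X₀ of x, so A = B is a common lower neighbour of the
  -- adjacent ancestors of c₁ and c₂.
  up-up-siblings : ∀ M → Separated M → ∀ {x y z c₁ c₂} → δ y ≤ suc M → y ≢ z →
                   Below y x → Below y c₁ → c₁ ≢ x → Below z x → Below z c₂ → c₂ ≢ x → ⊥
  up-up-siblings M ih {x} {y} {z} {c₁} {c₂} y≤1+M y≢z
                 y-below-x y-below-c₁ c₁≢x z-below-x z-below-c₂ c₂≢x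
    with c₁ ≟ᶠ c₂
  ... | yes refl = no-square (≢-sym c₁≢x) y≢z (below-adj y-below-x) (proj₁ y-below-c₁)
                     (below-adj z-below-c₂) (below-adj z-below-x)
                     (siblings-not-adj y-below-x y-below-c₁)
                     (no-triangle (proj₁ y-below-x) (below-adj z-below-x))
  ... | no c₁≢c₂ with ancestor (suc K) c₁ ≟ᶠ ancestor (suc K) c₂
  ...   | no A≢B = Separated.flat-flat ih X₀ (ancestor (suc K) c₁) (ancestor (suc K) c₂)
                     (ancestor-depth (suc K) (below-< y-below-x) y≤1+M)
                     (flat-X₀ y-below-x y-below-c₁ c₁≢x) (flat-X₀ z-below-x z-below-c₂ c₂≢x) A≢B
    where
    X₀ = ancestor (suc K) x
    flat-X₀ : ∀ {v c} → Below v x → Below v c → c ≢ x → Flat X₀ (ancestor (suc K) c)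
    flat-X₀ v-below-x v-below-c c≢x =
      siblings-meet (≢-sym c≢x) v-below-x v-below-c , ancestor-δ-≡ (suc K) (below-δ v-below-c v-below-x)
  ...   | yes A≡B = no-triangle ab (proj₁ b-below-A) (proj₁ a-below-A)
    where
    a = ancestor K c₁
    b = ancestor K c₂
    ab : Adj G a b
    ab = up-up-arch-meets y≢z c₁≢c₂ y-below-x y-below-c₁ c₁≢x z-below-x z-below-c₂ c₂≢x
    b~a : δ b ≡ δ a
    b~a = ancestor-δ-≡ K (trans (below-δ z-below-c₂ z-below-x) (below-δ y-below-x y-below-c₁))
    a-below-A : Below a (ancestor (suc K) c₁)
    a-below-A = ancestor-below K (flat-non-root (ab , b~a))
    b-below-A : Below b (ancestor (suc K) c₁)
    b-below-A = subst (Below b) (sym A≡B) (ancestor-below K (flat-non-root (adj-sym ab , sym b~a)))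

  up-up-step : ∀ M → Separated M → ∀ x y z → δ y ≤ suc M → Up x y → Up x z → y ≢ z → ⊥
  up-up-step M ih x y z y≤1+M (y-below-x , two-y) (z-below-x , two-z) y≢z =
    up-up-siblings M ih y≤1+M y≢z y-below-x (proj₁ (proj₂ c₁)) (proj₂ (proj₂ c₁))
                                 z-below-x (proj₁ (proj₂ c₂)) (proj₂ (proj₂ c₂))
    where
    c₁ = other-below x two-y
    c₂ = other-below x two-z

  nothing-below-depth-0 : ∀ {v w} → δ v ≤ 0 → ¬ Below v w
  nothing-below-depth-0 v≤0 below = n≮0 (<-≤-trans (below-< below) v≤0)

  separated : ∀ M → Separated M
  separated zero = record
    { down-flat = λ _ _ _ x≤0 down _ → nothing-below-depth-0 x≤0 (proj₁ down)
    ; down-up   = λ _ _ _ z≤0 _ up → nothing-below-depth-0 z≤0 (proj₁ up)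
    ; flat-flat = λ x _ _ x≤0 flat _ _ → flat-non-root flat (δ≡0⇒root (n≤0⇒n≡0 x≤0))
    ; flat-up   = λ _ _ _ z≤0 _ up → nothing-below-depth-0 z≤0 (proj₁ up)
    ; up-up     = λ _ _ _ y≤0 up _ _ → nothing-below-depth-0 y≤0 (proj₁ up) }
  separated (suc M) = record
    { down-flat = down-flat-step M ih
    ; down-up   = down-up-step M ih
    ; flat-flat = flat-flat-step M ih
    ; flat-up   = flat-up-step M ih
    ; up-up     = up-up-step M ih }
    where ih = separated M

  NonTreeKind : Fin n → Fin n → Set
  NonTreeKind x y = (Below x y × y ≢ parentOf x) ⊎ Flat x y ⊎ Up x y

  non-tree-kind : ∀ {x y} → NonTreeEdge T x y → NonTreeKind x y
  non-tree-kind {x} {y} (xy , not-tree) with <-cmp (δ y) (δ x)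
  ... | tri< y<x _ _ =
    inj₁ (below-y , λ y≡p → not-tree (inj₂ (parentOf-tree (below-non-root below-y) y≡p)))
    where below-y = adj-<⇒below xy y<x
  ... | tri≈ _ y~x _ = inj₂ (inj₁ (xy , y~x))
  ... | tri> _ _ x<y = inj₂ (inj₂ (below-x , other-than-parent below-x
                         λ x≡p → not-tree (inj₁ (parentOf-tree (below-non-root below-x) x≡p))))
    where below-x = adj-<⇒below (adj-sym xy) x<y

  non-tree-edges-match : ∀ x y z → NonTreeEdge T x y → NonTreeEdge T x z → y ≡ z
  non-tree-edges-match x y z e₁ e₂ with y ≟ᶠ z
  ... | yes y≡z = y≡z
  ... | no y≢z = ⊥-elim (clash (non-tree-kind e₁) (non-tree-kind e₂))
    where
    open Separated
    down : ∀ {v} → Below x v × v ≢ parentOf x → Down x v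
    down (below , v≢p) = below , other-than-parent below v≢p
    clash : NonTreeKind x y → NonTreeKind x z → ⊥
    clash (inj₁ (below-y , y≢p)) (inj₁ (below-z , z≢p)) =
      no-three-below y≢z y≢p z≢p below-y below-z (parentOf-below (below-non-root below-y))
    clash (inj₁ d) (inj₂ (inj₁ f))         = down-flat (separated (δ x)) x y z ≤-refl (down d) f
    clash (inj₁ d) (inj₂ (inj₂ u))         = down-up (separated (δ z)) x y z ≤-refl (down d) u
    clash (inj₂ (inj₁ f)) (inj₁ d)         = down-flat (separated (δ x)) x z y ≤-refl (down d) f
    clash (inj₂ (inj₁ f)) (inj₂ (inj₁ f′)) = flat-flat (separated (δ x)) x y z ≤-refl f f′ y≢z
    clash (inj₂ (inj₁ f)) (inj₂ (inj₂ u))  = flat-up (separated (δ z)) x y z ≤-refl f u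
    clash (inj₂ (inj₂ u)) (inj₁ d)         = down-up (separated (δ y)) x z y ≤-refl (down d) u
    clash (inj₂ (inj₂ u)) (inj₂ (inj₁ f))  = flat-up (separated (δ y)) x z y ≤-refl f u
    clash (inj₂ (inj₂ u)) (inj₂ (inj₂ u′)) = up-up (separated (δ y)) x y z ≤-refl u u′ y≢z

lemma7 : (k : ℕ) → 2 ≤ k → (n : ℕ) → (G : Graph n) → Connected G → SC (2 * k + 1) G →
    (r : Fin n) → (T : BFSTree G r) →
    ∀ x y z → NonTreeEdge T x y → NonTreeEdge T x z → y ≡ z
lemma7 .(suc (suc K)) (s≤s (s≤s {n = K} _)) n G conn sc r T =
  SCBreadthFirst.non-tree-edges-match K G conn sc r T
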